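{- For every finite connected graph $G$ and every vertex $s$ of $G$, $sl(G)\le \left\lfloor \frac{3}{2}\Delta_s(G)\right\rfloor$.
   Context: All graphs are finite, connected, unweighted, undirected, without loops or multiple edges; $d_G$ is the shortest-path metric and $B_r(s)=\{v: d_G(v,s)\le r\}$. A geodesic triangle $\triangle(x,y,z)$ is the union $P(x,y)\cup P(x,z)\cup P(y,z)$ of three shortest paths connecting $x,y,z$; it is $\delta$-slim if every vertex on any side is at distance at most $\delta$ from the union of the other two sides. The slimness $sl(G)$ is the smallest $\delta$ such that all geodesic triangles of $G$ are $\delta$-slim. For a vertex $s$ with eccentricity $r$, the layers are $L^i(s)=\{u: d_G(s,u)=i\}$, $i=0,\dots,r$; the layering partition $\mathcal{LP}(G,s)$ partitions each layer $L^i(s)$ into clusters such that two vertices $u,v\in L^i(s)$ lie in the same cluster iff they can be connected by a path in $G$ avoiding $B_{i-1}(s)$. $\Delta_s(G)=\max_{C\in\mathcal{LP}(G,s)}\max_{u,v\in C}d_G(u,v)$. -}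

module Defs where

open import Data.Nat using (ℕ; zero; suc; _≤_; _<_)
open import Data.Fin using (Fin)
open import Data.Bool using (Bool; true; false)
open import Data.Product using (Σ; ∃; ∃-syntax; _×_; _,_)
open import Data.Sum using (_⊎_)
open import Relation.Binary.PropositionalEquality using (_≡_)

record Graph (n : ℕ) : Set where
  field
    adj   : Fin n → Fin n → Bool
    sym   : ∀ u v → adj u v ≡ adj v u
    irrefl : ∀ u → adj u u ≡ false

module _ {n : ℕ} (G : Graph n) where
  open Graph G

  Adj : Fin n → Fin n → Set
  Adj u v = adj u v ≡ true

  data Walk : Fin n → Fin n → ℕ → Set where
    []   : (u : Fin n) → Walk u u 0
    step : (u : Fin n) {v w : Fin n} {k : ℕ} → Adj u v → Walk v w k → Walk u w (suc k)

  data OnWalk (x : Fin n) : {u w : Fin n} {k : ℕ} → Walk u w k → Set where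
    here-[]  : OnWalk x ([] x)
    here     : ∀ {v w k} (e : Adj x v) (p : Walk v w k) → OnWalk x (step x e p)
    there    : ∀ {u v w k} (e : Adj u v) {p : Walk v w k} → OnWalk x p → OnWalk x (step u e p)

  Connected : Set
  Connected = ∀ u v → ∃[ k ] Walk u v k

  Dist : Fin n → Fin n → ℕ → Set
  Dist u v k = Walk u v k × (∀ m → Walk u v m → k ≤ m)

  DistLe : Fin n → Fin n → ℕ → Set
  DistLe u v m = ∃[ k ] (k ≤ m × Walk u v k)

  Geodesic : ∀ {u v k} → Walk u v k → Set
  Geodesic {u} {v} {k} _ = ∀ m → Walk u v m → k ≤ m

  SideClose : ∀ {a b c d e f k l m} → ℕ → Walk a b k → Walk c d l → Walk e f m → Set
  SideClose δ p q r =
    ∀ x → OnWalk x p → ∃[ y ] ((OnWalk y q ⊎ OnWalk y r) × DistLe x y δ)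

  TriangleSlim : ∀ {x y z k l m} → ℕ → Walk x y k → Walk x z l → Walk y z m → Set
  TriangleSlim δ pxy pxz pyz =
    SideClose δ pxy pxz pyz × SideClose δ pxz pxy pyz × SideClose δ pyz pxy pxz

  AllSlim : ℕ → Set
  AllSlim δ = ∀ x y z {k l m} (pxy : Walk x y k) (pxz : Walk x z l) (pyz : Walk y z m) →
    Geodesic pxy → Geodesic pxz → Geodesic pyz → TriangleSlim δ pxy pxz pyz

  IsSlimness : ℕ → Set
  IsSlimness σ = AllSlim σ × (∀ δ → AllSlim δ → σ ≤ δ)

  OutsideBall : Fin n → ℕ → Fin n → Set
  OutsideBall s i w = ∀ m → Walk s w m → i ≤ m

  -- u and v lie in the same cluster of layer L^i(s) of the layering partition LP(G,s).
  SameCluster : Fin n → ℕ → Fin n → Fin n → Set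
  SameCluster s i u v =
    Dist s u i × Dist s v i ×
    Σ ℕ (λ k → Σ (Walk u v k) (λ p → ∀ w → OnWalk w p → OutsideBall s i w))

  IsDeltaS : Fin n → ℕ → Set
  IsDeltaS s D =
    (∀ i u v k → SameCluster s i u v → Dist u v k → k ≤ D) ×
    (∃[ i ] ∃[ u ] ∃[ v ] (SameCluster s i u v × Dist u v D))

-- Let w lie on a geodesic P(u,v) and let W be another u–v walk. Call vertices linked
-- at level j when they lie in one component of G − B_{j-1}(s); the clusters of LP(G,s)
-- are the layer-j parts of these components. Taking j maximal with u, v linked (and,
-- if w is linked to them there, maximal with w linked to u or v), one finds a cluster C
-- met by W that either contains w or is met by P on both sides of w, at a and a′. In
-- the first case d(w,W) ≤ Δ. In the second, d(a,w) + d(w,a′) = d(a,a′) ≤ Δ because P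
-- is a geodesic, so one term is at most Δ/2 and d(w,W) ≤ Δ/2 + Δ = ⌊3Δ/2⌋.
-- Maximal levels and exit edges of walks are found in the double-negation monad; the
-- conclusion is decidable, so this is harmless.
module Submission where

open import Defs
open import Data.Nat using (ℕ; zero; suc; _+_; _*_; _/_; _≤_; _<_; z≤n; s≤s)
open import Data.Nat.Properties
open import Data.Nat.DivMod using (m*n/n≡m; /-monoˡ-≤; /-congˡ; +-distrib-/-∣ʳ)
open import Data.Nat.Divisibility using (m∣m*n)
open import Data.Nat.Induction using (<-rec)
open import Data.Fin using (Fin) renaming (_≟_ to _≟ᶠ_)
open import Data.Fin.Properties using (any?)
open import Data.Bool using (true) renaming (_≟_ to _≟ᵇ_)
open import Data.Product using (Σ; ∃-syntax; _×_; _,_; proj₁; proj₂)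
open import Data.Sum using (_⊎_; inj₁; inj₂; [_,_]′)
import Data.Sum as Sum
open import Effect.Monad using (RawMonad)
open import Function using (_∘_)
open import Level using (0ℓ)
open import Relation.Nullary using (¬_; Dec; yes; no; _×-dec_; _⊎-dec_; contradiction)
open import Relation.Nullary.Decidable using (map′; decidable-stable; ¬¬-excluded-middle)
open import Relation.Nullary.Negation using (¬¬-Monad)
open import Relation.Binary.PropositionalEquality using (_≡_; refl; sym; trans; cong; subst; module ≡-Reasoning)

open RawMonad (¬¬-Monad {0ℓ})

≤half-of-double : ∀ {a D} → a + a ≤ D → a ≤ D / 2
≤half-of-double {a} {D} 2a≤D = begin
  a           ≡⟨ sym (m*n/n≡m a 2) ⟩
  a * 2 / 2   ≤⟨ /-monoˡ-≤ 2 (subst (_≤ D) (sym a*2≡a+a) 2a≤D) ⟩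
  D / 2       ∎
  where
  open ≤-Reasoning
  a*2≡a+a : a * 2 ≡ a + a
  a*2≡a+a = trans (*-comm a 2) (cong (a +_) (+-identityʳ a))

≤half-or-≤half : ∀ {a b D} → a + b ≤ D → a ≤ D / 2 ⊎ b ≤ D / 2
≤half-or-≤half {a} {b} a+b≤D with ≤-total a b
... | inj₁ a≤b = inj₁ (≤half-of-double (≤-trans (+-monoʳ-≤ a a≤b) a+b≤D))
... | inj₂ b≤a = inj₂ (≤half-of-double (≤-trans (+-monoˡ-≤ b b≤a) a+b≤D))

three-halves : ∀ D → 3 * D / 2 ≡ D / 2 + D
three-halves D = begin
  (D + 2 * D) / 2     ≡⟨ +-distrib-/-∣ʳ D (m∣m*n D) ⟩
  D / 2 + 2 * D / 2   ≡⟨ cong (D / 2 +_) (trans (/-congˡ (*-comm 2 D)) (m*n/n≡m D 2)) ⟩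
  D / 2 + D           ∎
  where open ≡-Reasoning

middle-≤ : ∀ a b c d k → (a + b) + (c + d) ≤ a + (k + d) → b + c ≤ k
middle-≤ a b c d k le = +-cancelʳ-≤ d (b + c) k (+-cancelˡ-≤ a ((b + c) + d) (k + d)
  (subst (_≤ a + (k + d)) reassoc le))
  where
  reassoc : (a + b) + (c + d) ≡ a + ((b + c) + d)
  reassoc = trans (+-assoc a b (c + d)) (cong (a +_) (sym (+-assoc b c d)))

¬¬-last : (Q : ℕ → Set) → Q 0 → ∀ N → ¬ Q N → ¬ ¬ (∃[ j ] (Q j × ¬ Q (suc j)))
¬¬-last Q q₀ zero    ¬q₀ = contradiction q₀ ¬q₀
¬¬-last Q q₀ (suc N) ¬qₙ₊₁ = ¬¬-excluded-middle >>= λ where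
  (yes qₙ) → return (N , qₙ , ¬qₙ₊₁)
  (no ¬qₙ) → ¬¬-last Q q₀ N ¬qₙ

module Walks {n : ℕ} (G : Graph n) where

  adj-sym : ∀ {u v} → Adj G u v → Adj G v u
  adj-sym {u} {v} e = trans (Graph.sym G v u) e

  infixr 5 _++_
  _++_ : ∀ {u v w k l} → Walk G u v k → Walk G v w l → Walk G u w (k + l)
  [] u       ++ q = q
  step u e p ++ q = step u e (p ++ q)

  snoc : ∀ {u v w k} → Walk G u v k → Adj G v w → Walk G u w (suc k)
  snoc ([] u)       e = step u e ([] _)
  snoc (step u f p) e = step u f (snoc p e)

  reverse : ∀ {u v k} → Walk G u v k → Walk G v u k
  reverse ([] u)       = [] u
  reverse (step u e p) = snoc (reverse p) (adj-sym e)

  onWalk-start : ∀ {u v k} (p : Walk G u v k) → OnWalk G u p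
  onWalk-start ([] u)       = here-[]
  onWalk-start (step u e p) = here e p

  onWalk-end : ∀ {u v k} (p : Walk G u v k) → OnWalk G v p
  onWalk-end ([] u)       = here-[]
  onWalk-end (step u e p) = there e (onWalk-end p)

  onWalk-++ : ∀ {x u v w k l} (p : Walk G u v k) {q : Walk G v w l} →
              OnWalk G x (p ++ q) → OnWalk G x p ⊎ OnWalk G x q
  onWalk-++ ([] u)       x∈q          = inj₂ x∈q
  onWalk-++ (step u e p) (here _ _)   = inj₁ (here e p)
  onWalk-++ (step u e p) (there _ x∈) = Sum.map₁ (there e) (onWalk-++ p x∈)

  onWalk-snoc : ∀ {x u v w k} (p : Walk G u v k) (e : Adj G v w) →
                OnWalk G x (snoc p e) → OnWalk G x p ⊎ x ≡ w
  onWalk-snoc ([] u)       e (here _ _)         = inj₁ here-[]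
  onWalk-snoc ([] u)       e (there _ here-[])  = inj₂ refl
  onWalk-snoc (step u f p) e (here _ _)         = inj₁ (here f p)
  onWalk-snoc (step u f p) e (there _ x∈)       = Sum.map₁ (there f) (onWalk-snoc p e x∈)

  onWalk-reverse : ∀ {x u v k} (p : Walk G u v k) → OnWalk G x (reverse p) → OnWalk G x p
  onWalk-reverse ([] u)       x∈ = x∈
  onWalk-reverse (step u e p) x∈ with onWalk-snoc (reverse p) (adj-sym e) x∈
  ... | inj₁ x∈p  = there e (onWalk-reverse p x∈p)
  ... | inj₂ refl = here e p

  splitAt : ∀ {x u v k} (p : Walk G u v k) → OnWalk G x p →
            ∃[ l₁ ] ∃[ l₂ ] (Walk G u x l₁ × Walk G x v l₂ × l₁ + l₂ ≡ k)
  splitAt ([] u)       here-[]      = 0 , 0 , [] u , [] u , refl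
  splitAt (step u e p) (here _ _)   = 0 , _ , [] u , step u e p , refl
  splitAt (step u e p) (there _ x∈) with splitAt p x∈
  ... | l₁ , l₂ , p₁ , p₂ , eq = suc l₁ , l₂ , step u e p₁ , p₂ , cong suc eq

  Meets : ∀ {u v k} → Walk G u v k → (Fin n → Set) → Set
  Meets p P = ∃[ x ] (OnWalk G x p × P x)

  meets-reverse : ∀ {u v k} {P : Fin n → Set} (p : Walk G u v k) → Meets (reverse p) P → Meets p P
  meets-reverse p (x , x∈ , px) = x , onWalk-reverse p x∈ , px

  distLe-trans : ∀ {x y z d e} → DistLe G x y d → DistLe G y z e → DistLe G x z (d + e)
  distLe-trans (k , k≤d , p) (l , l≤e , q) = k + l , +-mono-≤ k≤d l≤e , p ++ q

  record Crossing (P : Fin n → Set) {u v k} (p : Walk G u v k) : Set where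
    field
      {from to} : Fin n
      from-on   : OnWalk G from p
      to-on     : OnWalk G to p
      edge      : Adj G from to
      from-in   : P from
      to-out    : ¬ P to

  crossing-there : ∀ {P u v w k} (e : Adj G u v) {p : Walk G v w k} → Crossing P p → Crossing P (step u e p)
  crossing-there e c = record
    { from-on = there e from-on ; to-on = there e to-on ; edge = edge ; from-in = from-in ; to-out = to-out }
    where open Crossing c

  ¬¬-crossing : ∀ (P : Fin n → Set) {u v k} (p : Walk G u v k) → P u → ¬ P v → ¬ ¬ Crossing P p
  ¬¬-crossing P ([] u) pu ¬pu = contradiction pu ¬pu
  ¬¬-crossing P (step u {v} e p) pu ¬pw = ¬¬-excluded-middle {A = P v} >>= λ where
    (yes pv) → crossing-there e <$> ¬¬-crossing P p pv ¬pw
    (no ¬pv) → return (record { from-on = here e p ; to-on = there e (onWalk-start p)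
                              ; edge = e ; from-in = pu ; to-out = ¬pv })

  walk? : ∀ k u v → Dec (Walk G u v k)
  walk? zero u v with u ≟ᶠ v
  ... | yes refl = yes ([] u)
  ... | no u≢v   = no λ { ([] _) → u≢v refl }
  walk? (suc k) u v with any? (λ x → (Graph.adj G u x ≟ᵇ true) ×-dec walk? k x v)
  ... | yes (x , e , p) = yes (step u e p)
  ... | no ∄            = no λ { (step _ e p) → ∄ (_ , e , p) }

  onWalk? : ∀ x {u v k} (p : Walk G u v k) → Dec (OnWalk G x p)
  onWalk? x ([] u) with x ≟ᶠ u
  ... | yes refl = yes here-[]
  ... | no x≢u   = no λ { here-[] → x≢u refl }
  onWalk? x (step u e p) with x ≟ᶠ u | onWalk? x p
  ... | yes refl | _       = yes (here e p)
  ... | no _     | yes x∈p = yes (there e x∈p)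
  ... | no x≢u   | no x∉p  = no λ { (here _ _) → x≢u refl ; (there _ x∈p) → x∉p x∈p }

  distLe? : ∀ u v d → Dec (DistLe G u v d)
  distLe? u v d = map′ (λ (k , k<1+d , p) → k , m<1+n⇒m≤n k<1+d , p)
                       (λ (k , k≤d , p) → k , s≤s k≤d , p)
                       (anyUpTo? (λ k → walk? k u v) (suc d))

  shortest : ∀ {u v} m → Walk G u v m → ∃[ k ] Dist G u v k
  shortest {u} {v} = <-rec (λ m → Walk G u v m → ∃[ k ] Dist G u v k) shorten
    where
    shorten : ∀ m → (∀ {k} → k < m → Walk G u v k → ∃[ k′ ] Dist G u v k′) →
              Walk G u v m → ∃[ k ] Dist G u v k
    shorten m rec p with anyUpTo? (λ k → walk? k u v) m
    ... | yes (k , k<m , q) = rec k<m q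
    ... | no ∄ = m , p , λ m′ q → ≮⇒≥ λ m′<m → ∄ (m′ , m′<m , q)

module Layering {n : ℕ} (G : Graph n) (connected : Connected G) (s : Fin n) where
  open Walks G

  Outside : ℕ → Fin n → Set
  Outside = OutsideBall G s

  outside-mono : ∀ {i j v} → i ≤ j → Outside j v → Outside i v
  outside-mono i≤j out m p = ≤-trans i≤j (out m p)

  outside-suc : ∀ {j v} → Outside j v → ¬ Walk G s v j → Outside (suc j) v
  outside-suc out ¬p m p = ≤∧≢⇒< (out m p) λ { refl → ¬p p }

  outside∧¬outside-suc⇒walk : ∀ {j v} → Outside j v → ¬ Outside (suc j) v → Walk G s v j
  outside∧¬outside-suc⇒walk {j} {v} out ¬out with anyUpTo? (λ m → walk? m s v) (suc j)
  ... | yes (m , m<1+j , p) = subst (Walk G s v) (≤-antisym (m<1+n⇒m≤n m<1+j) (out m p)) p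
  ... | no ∄ = contradiction (λ m p → ≮⇒≥ λ m<1+j → ∄ (m , m<1+j , p)) ¬out

  Linked : ℕ → Fin n → Fin n → Set
  Linked j u v = ∃[ k ] Σ (Walk G u v k) λ p → ∀ x → OnWalk G x p → Outside j x

  -- v belongs to the cluster of layer L^j(s) inside the component of c.
  InCluster : ℕ → Fin n → Fin n → Set
  InCluster j c v = Linked j c v × Walk G s v j

  linked-zero : ∀ u v → Linked 0 u v
  linked-zero u v with connected u v
  ... | k , p = k , p , λ _ _ _ _ → z≤n

  linked-mono : ∀ {i j u v} → i ≤ j → Linked j u v → Linked i u v
  linked-mono i≤j (k , p , out) = k , p , λ x x∈ → outside-mono i≤j (out x x∈)

  linked-start : ∀ {j u v} → Linked j u v → Outside j u
  linked-start (_ , p , out) = out _ (onWalk-start p)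

  linked-end : ∀ {j u v} → Linked j u v → Outside j v
  linked-end (_ , p , out) = out _ (onWalk-end p)

  linked-refl : ∀ {j u} → Outside j u → Linked j u u
  linked-refl out = 0 , [] _ , λ { _ here-[] → out }

  linked-sym : ∀ {j u v} → Linked j u v → Linked j v u
  linked-sym (k , p , out) = k , reverse p , λ x x∈ → out x (onWalk-reverse p x∈)

  linked-trans : ∀ {j u v w} → Linked j u v → Linked j v w → Linked j u w
  linked-trans (k , p , out) (l , q , out′) =
    k + l , p ++ q , λ x x∈ → [ out x , out′ x ]′ (onWalk-++ p x∈)

  linked-snoc : ∀ {j u v w} → Linked j u v → Adj G v w → Outside j w → Linked j u w
  linked-snoc (k , p , out) e outw =
    suc k , snoc p e , λ x x∈ → [ out x , (λ { refl → outw }) ]′ (onWalk-snoc p e x∈)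

  inCluster-trans : ∀ {j c u v} → Linked j c u → InCluster j u v → InCluster j c v
  inCluster-trans cu (uv , sv) = linked-trans cu uv , sv

  inCluster⇒sameCluster : ∀ {j c a b} → InCluster j c a → InCluster j c b → SameCluster G s j a b
  inCluster⇒sameCluster (ca , sa) (cb , sb) with linked-trans (linked-sym ca) cb
  ... | k , p , out = (sa , linked-end ca) , (sb , linked-end cb) , k , p , out

  leaving-edge : ∀ {j c a b} → Linked (suc j) c a → Adj G a b → ¬ Linked (suc j) c b →
                 Walk G s a (suc j) × InCluster j c b
  leaving-edge {j} ca e ¬cb = snoc sb (adj-sym e) , linked-snoc (linked-mono (n≤1+n j) ca) e outb , sb
    where
    outb : Outside j _
    outb m p = ≤-pred (linked-end ca (suc m) (snoc p (adj-sym e)))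
    sb : Walk G s _ j
    sb = outside∧¬outside-suc⇒walk outb (¬cb ∘ linked-snoc ca e)

  ¬¬-meets-upper : ∀ {j c x y k} (p : Walk G x y k) → Linked j c x → ¬ Linked j c y →
                   ¬ ¬ Meets p (InCluster j c)
  ¬¬-meets-upper {zero} {c} {y = y} p _ ¬cy = contradiction (linked-zero c y) ¬cy
  ¬¬-meets-upper {suc j} {c} p cx ¬cy = do
    cross ← ¬¬-crossing (Linked (suc j) c) p cx ¬cy
    let open Crossing cross
    return (from , from-on , from-in , proj₁ (leaving-edge from-in edge to-out))

  ¬¬-meets-lower : ∀ {j c x y k} (p : Walk G x y k) → Linked (suc j) c x → ¬ Linked (suc j) c y →
                   ¬ ¬ Meets p (InCluster j c)
  ¬¬-meets-lower {j} {c} p cx ¬cy = do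
    cross ← ¬¬-crossing (Linked (suc j) c) p cx ¬cy
    let open Crossing cross
    return (to , to-on , proj₂ (leaving-edge from-in edge to-out))

  ¬¬-meets-cluster : ∀ {j c x y k} (p : Walk G x y k) → Linked j c x → ¬ Linked (suc j) x y →
                     ¬ ¬ Meets p (InCluster j c)
  ¬¬-meets-cluster {j} {x = x} p cx ¬xy with walk? j s x
  ... | yes sx = return (x , onWalk-start p , cx , sx)
  ... | no ¬sx = do
    (b , b∈ , xb) ← ¬¬-meets-lower p (linked-refl (outside-suc (linked-end cx) ¬sx)) ¬xy
    return (b , b∈ , inCluster-trans cx xb)

  ¬¬-last-level : ∀ (Q : ℕ → Set) {x} → Q 0 → (∀ {j} → Q j → Outside j x) →
                  ¬ ¬ (∃[ j ] (Q j × ¬ Q (suc j)))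
  ¬¬-last-level Q {x} q₀ outside with connected s x
  ... | L , p = ¬¬-last Q q₀ (suc L) λ q → n≮n L (outside q L p)

  module Slim (D : ℕ) (diameter : ∀ i u v k → SameCluster G s i u v → Dist G u v k → k ≤ D) where

    cluster-distLe : ∀ {j c a b} → InCluster j c a → InCluster j c b → DistLe G a b D
    cluster-distLe ia ib with linked-trans (linked-sym (proj₁ ia)) (proj₁ ib)
    ... | _ , p , _ with shortest _ p
    ...   | k , d = k , diameter _ _ _ k (inCluster⇒sameCluster ia ib) d , proj₁ d

    Near : ∀ {u v m} → Fin n → Walk G u v m → Set
    Near w W = Meets W λ y → DistLe G w y (D / 2 + D)

    near-in-cluster : ∀ {j c w u v m} (W : Walk G u v m) →
                      InCluster j c w → Meets W (InCluster j c) → Near w W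
    near-in-cluster W iw (b , b∈ , ib) with cluster-distLe iw ib
    ... | k , k≤D , p = b , b∈ , k , ≤-trans k≤D (m≤n+m D (D / 2)) , p

    near-across : ∀ {j c u v w l₁ l₂ m} (p₁ : Walk G u w l₁) (p₂ : Walk G w v l₂) →
                  (∀ T → Walk G u v T → l₁ + l₂ ≤ T) → (W : Walk G u v m) →
                  Meets p₁ (InCluster j c) → Meets p₂ (InCluster j c) → Meets W (InCluster j c) →
                  Near w W
    near-across p₁ p₂ geodesic W (a , a∈ , ia) (a′ , a′∈ , ia′) (b , b∈ , ib)
      with splitAt p₁ a∈ | splitAt p₂ a′∈ | cluster-distLe ia ia′
    ... | m₀ , m₁ , q , q′ , refl | m₂ , m₃ , r , r′ , refl | k , k≤D , t
      with ≤half-or-≤half (≤-trans (middle-≤ m₀ m₁ m₂ m₃ k (geodesic _ (q ++ t ++ r′))) k≤D)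
    ... | inj₁ m₁≤ = b , b∈ , distLe-trans (m₁ , m₁≤ , reverse q′) (cluster-distLe ia ib)
    ... | inj₂ m₂≤ = b , b∈ , distLe-trans (m₂ , m₂≤ , r) (cluster-distLe ia′ ib)

    module _ {u v w l₁ l₂ m} (p₁ : Walk G u w l₁) (p₂ : Walk G w v l₂)
             (geodesic : ∀ T → Walk G u v T → l₁ + l₂ ≤ T) (W : Walk G u v m) where

      near-off-component : ∀ {K} → Linked K u v → ¬ Linked (suc K) u v → ¬ Linked K u w →
                           ¬ ¬ Near w W
      near-off-component uv ¬uv ¬uw = do
        a  ← ¬¬-meets-upper p₁ (linked-refl (linked-start uv)) ¬uw
        a′ ← ¬¬-meets-upper (reverse p₂) uv ¬uw
        b  ← ¬¬-meets-cluster W (linked-refl (linked-start uv)) ¬uv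
        return (near-across p₁ p₂ geodesic W a (meets-reverse p₂ a′) b)

      near-at-branching : ∀ {J} → Outside J w → ¬ Linked (suc J) w u → ¬ Linked (suc J) w v →
                          Meets W (InCluster J w) → ¬ ¬ Near w W
      near-at-branching {J} outJ ¬wu ¬wv b with walk? J s w
      ... | yes sw = return (near-in-cluster W (linked-refl outJ , sw) b)
      ... | no ¬sw = do
        let ww = linked-refl (outside-suc outJ ¬sw)
        a  ← ¬¬-meets-lower (reverse p₁) ww ¬wu
        a′ ← ¬¬-meets-lower p₂ ww ¬wv
        return (near-across p₁ p₂ geodesic W (meets-reverse p₁ a) a′ b)

      near-on-component : ∀ {K} → Linked K u w → ¬ Linked (suc K) u v → ¬ ¬ Near w W
      near-on-component uw ¬uv = do
        (J , wJ , ¬wJ+1) ← ¬¬-last-level LinkedToEnd (inj₁ (linked-zero w u)) outside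
        let K≤J = ≮⇒≥ λ J<K → ¬wJ+1 (Sum.map (linked-mono J<K) (linked-mono J<K)
                                                (inj₁ (linked-sym uw)))
            ¬uvJ+1 = ¬uv ∘ linked-mono (s≤s K≤J)
        b ← [ (λ wu → ¬¬-meets-cluster W wu ¬uvJ+1)
            , (λ wv → meets-reverse W <$> ¬¬-meets-cluster (reverse W) wv (¬uvJ+1 ∘ linked-sym))
            ]′ wJ
        near-at-branching (outside wJ) (¬wJ+1 ∘ inj₁) (¬wJ+1 ∘ inj₂) b
        where
        LinkedToEnd : ℕ → Set
        LinkedToEnd j = Linked j w u ⊎ Linked j w v
        outside : ∀ {j} → LinkedToEnd j → Outside j w
        outside = [ linked-start , linked-start ]′

      ¬¬-near : ¬ ¬ Near w W
      ¬¬-near = do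
        (K , uv , ¬uv) ← ¬¬-last-level (λ j → Linked j u v) (linked-zero u v) linked-start
        ¬¬-excluded-middle >>= λ where
          (yes uw) → near-on-component uw ¬uv
          (no ¬uw) → near-off-component uv ¬uv ¬uw

    sideClose : ∀ {x y a b c d k l m r} (P : Walk G x y k) → Geodesic G P →
                (q : Walk G a b l) (q′ : Walk G c d m) (W : Walk G x y r) →
                (∀ z → OnWalk G z W → OnWalk G z q ⊎ OnWalk G z q′) →
                SideClose G (D / 2 + D) P q q′
    sideClose P geodesic q q′ W W⊆ w w∈P with splitAt P w∈P
    ... | l₁ , l₂ , p₁ , p₂ , refl =
      decidable-stable (any? λ y → (onWalk? y q ⊎-dec onWalk? y q′) ×-dec distLe? w y (D / 2 + D))
        ((λ (y , y∈ , near) → y , W⊆ y y∈ , near) <$> ¬¬-near p₁ p₂ geodesic W)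

    allSlim : AllSlim G (D / 2 + D)
    allSlim x y z pxy pxz pyz gxy gxz gyz =
        sideClose pxy gxy pxz pyz (pxz ++ reverse pyz)
          (λ t → Sum.map₂ (onWalk-reverse pyz) ∘ onWalk-++ pxz)
      , sideClose pxz gxz pxy pyz (pxy ++ pyz) (λ t → onWalk-++ pxy)
      , sideClose pyz gyz pxy pxz (reverse pxy ++ pxz)
          (λ t → Sum.map₁ (onWalk-reverse pxy) ∘ onWalk-++ (reverse pxy))

corollary1 : (n : ℕ) (G : Graph n) → Connected G → (s : Fin n) → (σ D : ℕ) →
    IsSlimness G σ → IsDeltaS G s D → σ ≤ (3 * D) / 2
corollary1 n G connected s σ D (_ , least) (diameter , _) = begin
  σ          ≤⟨ least _ (Layering.Slim.allSlim G connected s D diameter) ⟩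
  D / 2 + D  ≡⟨ sym (three-halves D) ⟩
  3 * D / 2  ∎
  where open ≤-Reasoning
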